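{- Let $a_1 \in \mathbb{Q}$ with $a_1 \neq 0$, let $b$ be a positive integer, and let $u = (u_n)_{n=-\infty}^{\infty}$ be a sequence with every term in $\mathbb{Z}[1/b]$ such that $u_{n+1} = a_1 u_n$ for all $n \in \mathbb{Z}$. Then no term $u_n$ is zero if and only if there is an integer $m \geq 2$ with $\gcd(b, m) = 1$ such that $u_n \notin m\mathbb{Z}[1/b]$ for every $n \in \mathbb{Z}$.
   Context: This is the case $d = 1$ of the exponential local-global principle (Skolem conjecture) for linear recurrences $u_{n+d} = a_1 u_{n+d-1} + \cdots + a_d u_n$ with $a_d \neq 0$ and simple characteristic roots. -}

module Defs where

open import Data.Nat using (ℕ; _^_)
open import Data.Integer using (ℤ; +_)
open import Data.Rational using (ℚ; _/_; _*_)
open import Data.Product using (∃-syntax; _×_)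
open import Relation.Binary.PropositionalEquality using (_≡_)

ℕtoℚ : ℕ → ℚ
ℕtoℚ n = + n / 1

-- x ∈ ℤ[1/b] : some b^k * x is an integer
InZinv : ℕ → ℚ → Set
InZinv b x = ∃[ k ] ∃[ z ] (ℕtoℚ (b ^ k) * x ≡ z / 1)

-- x ∈ m ℤ[1/b] : x = m * y for some y ∈ ℤ[1/b]
InMulZinv : ℕ → ℕ → ℚ → Set
InMulZinv b m x = ∃[ y ] (InZinv b y × x ≡ ℕtoℚ m * y)

{-# OPTIONS --safe #-}
module Submission where

-- Write a = P/Q in lowest terms (P = ↥ a, Q = ↧ a). The recurrence reads Q·uₙ₊₁ = P·uₙ,
-- so for m coprime to b, P and Q, multiplication by P or Q is invertible on
-- ℤ[1/b]/mℤ[1/b], and uₙ ∈ mℤ[1/b] holds either for all n or for none. Writing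
-- u₀ = N/bᵏ with N ≠ 0, the modulus m = 1 + b·|N|·|P|·Q is coprime to b, N, P and Q;
-- an element N/bᵏ of mℤ[1/b] with m coprime to b has m ∣ N, so u₀, and hence every uₙ,
-- lies outside mℤ[1/b]. Conversely 0 ∈ mℤ[1/b] for every m.

open import Defs
open import Data.Nat using (ℕ; _≤_)
open import Data.Nat.GCD using (gcd)
open import Data.Integer using (ℤ) renaming (_+_ to _+ℤ_; 1ℤ to 1ℤ)
open import Data.Rational using (ℚ; 0ℚ; _*_)
open import Data.Product using (∃-syntax; _×_)
open import Function.Bundles using (_⇔_)
open import Relation.Nullary using (¬_)
open import Relation.Binary.PropositionalEquality using (_≡_; _≢_)

open import Algebra.Bundles using (module CommutativeMonoid)
open import Data.Integer as ℤ using (+_; -[1+_]; 0ℤ; ∣_∣)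
import Data.Integer.Coprimality as ℤC
import Data.Integer.Divisibility as ℤ∣
import Data.Integer.Divisibility.Signed as ℤ∣ˢ
import Data.Integer.Properties as ℤP
open import Data.Nat as ℕ using (suc; zero; _^_; NonZero; s≤s)
open import Data.Nat.Coprimality using (Coprime; coprime-divisor; coprime⇒gcd≡1; 1-coprimeTo)
  renaming (sym to coprime-sym)
open import Data.Nat.Divisibility
  using (_∣_; ∣-refl; ∣-trans; ∣1⇒≡1; ∣m+n∣m⇒∣n; m∣m*n; n∣m*n; n∣m*n*o; ∣m⇒∣m*n)
import Data.Nat.Properties as ℕP
open import Data.Product using (_,_)
open import Data.Rational as ℚ using (↥_; ↧_; ↧ₙ_; mkℚ; 1ℚ; _/_; 1/_)
open import Data.Rational.Literals using (fromℤ)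
import Data.Rational.Properties as ℚP
open import Data.Rational.Unnormalised using (*≡*)
import Data.Rational.Unnormalised.Properties as ℚᵘP
open import Function.Base using (_∘_)
open import Function.Bundles using (mk⇔)
open import Relation.Binary.PropositionalEquality
  using (sym; trans; cong; cong₂; subst; module ≡-Reasoning)
open import Relation.Unary using (Pred)

open import Algebra.Properties.CommutativeSemigroup
  (CommutativeMonoid.commutativeSemigroup ℚP.*-1-commutativeMonoid) using (x∙yz≈y∙xz)

/1≡fromℤ : ∀ i → i / 1 ≡ fromℤ i
/1≡fromℤ i = ℚP.↥p/↧p≡p (fromℤ i)

/1-injective : ∀ {i j} → i / 1 ≡ j / 1 → i ≡ j
/1-injective {i} {j} eq = cong ↥_ (trans (sym (/1≡fromℤ i)) (trans eq (/1≡fromℤ j)))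

/1-homo-* : ∀ i j → (i ℤ.* j) / 1 ≡ (i / 1) * (j / 1)
/1-homo-* i j = begin
  (i ℤ.* j) / 1         ≡⟨ /1≡fromℤ (i ℤ.* j) ⟩
  fromℤ (i ℤ.* j)       ≡⟨ ℚP.toℚᵘ-injective (ℚᵘP.≃-sym (ℚP.toℚᵘ-homo-* (fromℤ i) (fromℤ j))) ⟩
  fromℤ i * fromℤ j     ≡⟨ sym (cong₂ _*_ (/1≡fromℤ i) (/1≡fromℤ j)) ⟩
  (i / 1) * (j / 1)     ∎
  where open ≡-Reasoning

-- In ℚᵘ the product is (n·d)/(d·1), which cross-multiplies against n/1 by associativity.
p*↧p≡↥p : ∀ p → p * (↧ p / 1) ≡ ↥ p / 1
p*↧p≡↥p p@(mkℚ n _ _) = begin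
  p * (↧ p / 1)    ≡⟨ cong (p *_) (/1≡fromℤ (↧ p)) ⟩
  p * fromℤ (↧ p)  ≡⟨ ℚP.toℚᵘ-injective (ℚᵘP.≃-trans (ℚP.toℚᵘ-homo-* p (fromℤ (↧ p)))
                                                      (*≡* (ℤP.*-assoc n (↧ p) (+ 1)))) ⟩
  fromℤ n          ≡⟨ sym (/1≡fromℤ n) ⟩
  n / 1            ∎
  where open ≡-Reasoning

ℕtoℚ-nonZero : ∀ n .{{_ : NonZero n}} → ℚ.NonZero (ℕtoℚ n)
ℕtoℚ-nonZero n = ℚ.≢-nonZero (λ n≡0 → ℕ.≢-nonZero⁻¹ n (ℤP.+-injective (/1-injective n≡0)))

p*q≡0⇒q≡0 : ∀ p q .{{_ : ℚ.NonZero p}} → p * q ≡ 0ℚ → q ≡ 0ℚ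
p*q≡0⇒q≡0 p q pq≡0 = begin
  q               ≡⟨ sym (ℚP.*-identityˡ q) ⟩
  1ℚ * q          ≡⟨ cong (_* q) (sym (ℚP.*-inverseˡ p)) ⟩
  1/ p * p * q    ≡⟨ ℚP.*-assoc (1/ p) p q ⟩
  1/ p * (p * q)  ≡⟨ cong (1/ p *_) pq≡0 ⟩
  1/ p * 0ℚ       ≡⟨ ℚP.*-zeroʳ (1/ p) ⟩
  0ℚ              ∎
  where open ≡-Reasoning

coprime-*ʳ : ∀ {m n o} → Coprime m n → Coprime m o → Coprime m (n ℕ.* o)
coprime-*ʳ m⊥n m⊥o (d∣m , d∣no) =
  m⊥o (d∣m , coprime-divisor (λ (e∣d , e∣n) → m⊥n (∣-trans e∣d d∣m , e∣n)) d∣no)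

coprime-^ʳ : ∀ {m n} → Coprime m n → ∀ k → Coprime m (n ^ k)
coprime-^ʳ {m} m⊥n zero    = coprime-sym (1-coprimeTo m)
coprime-^ʳ     m⊥n (suc k) = coprime-*ʳ m⊥n (coprime-^ʳ m⊥n k)

∣⇒coprime-suc : ∀ {d n} → d ∣ n → Coprime (suc n) d
∣⇒coprime-suc {n = n} d∣n {i} (i∣1+n , i∣d) =
  ∣1⇒≡1 (∣m+n∣m⇒∣n (subst (i ∣_) (ℕP.+-comm 1 n) i∣1+n) (∣-trans i∣d d∣n))

suc-∤-divisor : ∀ {d n} .{{_ : NonZero n}} → d ∣ n → ¬ suc n ∣ d
suc-∤-divisor {n = n} d∣n 1+n∣d =
  ℕ.≢-nonZero⁻¹ n (ℕP.suc-injective (∣⇒coprime-suc d∣n (∣-refl , 1+n∣d)))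

InMulZinv-0 : ∀ b m → InMulZinv b m 0ℚ
InMulZinv-0 b m = 0ℚ , (0 , 0ℤ , ℚP.*-zeroʳ (ℕtoℚ 1)) , sym (ℚP.*-zeroʳ (ℕtoℚ m))

-- N is a numerator of x at scale B when B·x = N; for x ∈ ℤ[1/b] the scales are powers of b.
numerator-*ˡ : ∀ {B x N} c → B * x ≡ N / 1 → B * ((c / 1) * x) ≡ (c ℤ.* N) / 1
numerator-*ˡ {B} {x} {N} c Bx≡N = begin
  B * ((c / 1) * x)  ≡⟨ x∙yz≈y∙xz B (c / 1) x ⟩
  (c / 1) * (B * x)  ≡⟨ cong ((c / 1) *_) Bx≡N ⟩
  (c / 1) * (N / 1)  ≡⟨ sym (/1-homo-* c N) ⟩
  (c ℤ.* N) / 1      ∎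
  where open ≡-Reasoning

numerators-cross : ∀ p q {M N x} → (p / 1) * x ≡ M / 1 → (q / 1) * x ≡ N / 1 →
                   p ℤ.* N ≡ q ℤ.* M
numerators-cross p q {M} {N} {x} px≡M qx≡N = /1-injective (begin
  (p ℤ.* N) / 1            ≡⟨ /1-homo-* p N ⟩
  (p / 1) * (N / 1)        ≡⟨ cong ((p / 1) *_) (sym qx≡N) ⟩
  (p / 1) * ((q / 1) * x)  ≡⟨ x∙yz≈y∙xz (p / 1) (q / 1) x ⟩
  (q / 1) * ((p / 1) * x)  ≡⟨ cong ((q / 1) *_) px≡M ⟩
  (q / 1) * (M / 1)        ≡⟨ sym (/1-homo-* q M) ⟩
  (q ℤ.* M) / 1            ∎)
  where open ≡-Reasoning

InMulZinv⇒numerator-multiple : ∀ {b m x} → InMulZinv b m x →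
                               ∃[ j ] ∃[ z ] (ℕtoℚ (b ^ j) * x ≡ (+ m ℤ.* z) / 1)
InMulZinv⇒numerator-multiple {b} {m} (y , (j , z , bʲy≡z) , x≡my) =
  j , z , trans (cong (ℕtoℚ (b ^ j) *_) x≡my)
                (numerator-*ˡ {ℕtoℚ (b ^ j)} {y} {z} (+ m) bʲy≡z)

InMulZinv⇒∣numerator : ∀ {b m k x N} → Coprime m b → ℕtoℚ (b ^ k) * x ≡ N / 1 →
                       InMulZinv b m x → + m ℤ∣.∣ N
InMulZinv⇒∣numerator {b} {m} {k} {x} {N} m⊥b bᵏx≡N x∈mℤ[1/b]
  with InMulZinv⇒numerator-multiple {b} {m} x∈mℤ[1/b]
... | j , z , bʲx≡mz = ℤC.coprime-divisor (+ m) (+ (b ^ j)) N (coprime-^ʳ m⊥b j) m∣bʲN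
  where
  bʲN≡bᵏmz : + (b ^ j) ℤ.* N ≡ + (b ^ k) ℤ.* (+ m ℤ.* z)
  bʲN≡bᵏmz = numerators-cross (+ (b ^ j)) (+ (b ^ k)) {+ m ℤ.* z} {N} {x} bʲx≡mz bᵏx≡N
  m∣bʲN : + m ℤ∣.∣ + (b ^ j) ℤ.* N
  m∣bʲN = ℤ∣ˢ.∣⇒∣ᵤ (subst (+ m ℤ∣ˢ.∣_) (sym bʲN≡bᵏmz)
                         (ℤ∣ˢ.∣n⇒∣m*n (+ (b ^ k)) (ℤ∣ˢ.∣m⇒∣m*n z ℤ∣ˢ.∣-refl)))

∣numerator⇒InMulZinv : ∀ {b m k x N} .{{_ : NonZero m}} → ℕtoℚ (b ^ k) * x ≡ N / 1 →
                       + m ℤ∣.∣ N → InMulZinv b m x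
∣numerator⇒InMulZinv {b} {m} {k} {x} {N} bᵏx≡N m∣N =
  x * 1/ M , (k , q , bᵏ[x/m]≡q) , x≡m[x/m]
  where
  open ℤ∣ˢ._∣_ (ℤ∣ˢ.∣ᵤ⇒∣ {+ m} {N} m∣N) renaming (quotient to q; equality to N≡q*m)
  open ≡-Reasoning
  M = ℕtoℚ m
  instance
    M≢0 : ℚ.NonZero M
    M≢0 = ℕtoℚ-nonZero m
  x≡m[x/m] : x ≡ M * (x * 1/ M)
  x≡m[x/m] = sym (begin
    M * (x * 1/ M)  ≡⟨ x∙yz≈y∙xz M x (1/ M) ⟩
    x * (M * 1/ M)  ≡⟨ cong (x *_) (ℚP.*-inverseʳ M) ⟩
    x * 1ℚ          ≡⟨ ℚP.*-identityʳ x ⟩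
    x               ∎)
  bᵏ[x/m]≡q : ℕtoℚ (b ^ k) * (x * 1/ M) ≡ q / 1
  bᵏ[x/m]≡q = begin
    ℕtoℚ (b ^ k) * (x * 1/ M)  ≡⟨ sym (ℚP.*-assoc (ℕtoℚ (b ^ k)) x (1/ M)) ⟩
    ℕtoℚ (b ^ k) * x * 1/ M    ≡⟨ cong (_* 1/ M) (trans bᵏx≡N (cong (_/ 1) N≡q*m)) ⟩
    (q ℤ.* + m) / 1 * 1/ M     ≡⟨ cong (_* 1/ M) (/1-homo-* q (+ m)) ⟩
    (q / 1) * M * 1/ M         ≡⟨ ℚP.*-assoc (q / 1) M (1/ M) ⟩
    (q / 1) * (M * 1/ M)       ≡⟨ cong ((q / 1) *_) (ℚP.*-inverseʳ M) ⟩
    (q / 1) * 1ℚ               ≡⟨ ℚP.*-identityʳ (q / 1) ⟩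
    q / 1                      ∎

InMulZinv-*ˡ : ∀ {b m x} c → InMulZinv b m x → InMulZinv b m ((c / 1) * x)
InMulZinv-*ˡ {b} {m} {x} c (y , (k , z , bᵏy≡z) , x≡my) =
  (c / 1) * y , (k , c ℤ.* z , numerator-*ˡ {ℕtoℚ (b ^ k)} {y} {z} c bᵏy≡z) ,
  trans (cong ((c / 1) *_) x≡my) (x∙yz≈y∙xz (c / 1) (ℕtoℚ m) y)

InMulZinv-cancelˡ : ∀ {b m x} c .{{_ : NonZero m}} → Coprime m b → Coprime m ∣ c ∣ →
                    InZinv b x → InMulZinv b m ((c / 1) * x) → InMulZinv b m x
InMulZinv-cancelˡ {b} {m} {x} c m⊥b m⊥c (k , N , bᵏx≡N) cx∈mℤ[1/b] =
  ∣numerator⇒InMulZinv {k = k} {N = N} bᵏx≡N (ℤC.coprime-divisor (+ m) c N m⊥c m∣cN)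
  where
  m∣cN : + m ℤ∣.∣ c ℤ.* N
  m∣cN = InMulZinv⇒∣numerator {k = k} {N = c ℤ.* N} m⊥b
           (numerator-*ˡ {ℕtoℚ (b ^ k)} {x} {N} c bᵏx≡N) cx∈mℤ[1/b]

closed-under-±1⇒at-0 : ∀ {ℓ} {P : Pred ℤ ℓ} → (∀ n → P n → P (n +ℤ 1ℤ)) →
                       (∀ n → P (n +ℤ 1ℤ) → P n) → ∀ n → P n → P 0ℤ
closed-under-±1⇒at-0         up down (+ zero)      p = p
closed-under-±1⇒at-0 {P = P} up down (+ suc k)     p =
  closed-under-±1⇒at-0 up down (+ k) (down (+ k) (subst P (cong +_ (ℕP.+-comm 1 k)) p))
closed-under-±1⇒at-0         up down -[1+ zero ]   p = up -[1+ zero ] p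
closed-under-±1⇒at-0         up down -[1+ suc k ]  p =
  closed-under-±1⇒at-0 up down -[1+ k ] (up -[1+ suc k ] p)

InMulZinv-at-0 : ∀ {a b m} {u : ℤ → ℚ} .{{_ : NonZero m}} →
                 Coprime m b → Coprime m ∣ ↥ a ∣ → Coprime m ∣ ↧ a ∣ →
                 (∀ n → InZinv b (u n)) → (∀ n → u (n +ℤ 1ℤ) ≡ a * u n) →
                 ∀ n → InMulZinv b m (u n) → InMulZinv b m (u 0ℤ)
InMulZinv-at-0 {a} {b} {m} {u} m⊥b m⊥↥a m⊥↧a u∈ℤ[1/b] u-rec =
  closed-under-±1⇒at-0 {P = InMulZinv b m ∘ u} forward backward
  where
  ↧a*u[n+1]≡↥a*u[n] : ∀ n → (↧ a / 1) * u (n +ℤ 1ℤ) ≡ (↥ a / 1) * u n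
  ↧a*u[n+1]≡↥a*u[n] n = begin
    (↧ a / 1) * u (n +ℤ 1ℤ)  ≡⟨ cong ((↧ a / 1) *_) (u-rec n) ⟩
    (↧ a / 1) * (a * u n)    ≡⟨ sym (ℚP.*-assoc (↧ a / 1) a (u n)) ⟩
    (↧ a / 1) * a * u n      ≡⟨ cong (_* u n) (trans (ℚP.*-comm (↧ a / 1) a) (p*↧p≡↥p a)) ⟩
    (↥ a / 1) * u n          ∎
    where open ≡-Reasoning
  forward : ∀ n → InMulZinv b m (u n) → InMulZinv b m (u (n +ℤ 1ℤ))
  forward n uₙ∈mℤ[1/b] =
    InMulZinv-cancelˡ {b} {m} {u (n +ℤ 1ℤ)} (↧ a) m⊥b m⊥↧a (u∈ℤ[1/b] (n +ℤ 1ℤ))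
      (subst (InMulZinv b m) (sym (↧a*u[n+1]≡↥a*u[n] n))
             (InMulZinv-*ˡ {b} {m} {u n} (↥ a) uₙ∈mℤ[1/b]))
  backward : ∀ n → InMulZinv b m (u (n +ℤ 1ℤ)) → InMulZinv b m (u n)
  backward n uₙ₊₁∈mℤ[1/b] =
    InMulZinv-cancelˡ {b} {m} {u n} (↥ a) m⊥b m⊥↥a (u∈ℤ[1/b] n)
      (subst (InMulZinv b m) (↧a*u[n+1]≡↥a*u[n] n)
             (InMulZinv-*ˡ {b} {m} {u (n +ℤ 1ℤ)} (↧ a) uₙ₊₁∈mℤ[1/b]))

numerator-nonZero : ∀ {b k x N} .{{_ : NonZero b}} →
                    ℕtoℚ (b ^ k) * x ≡ N / 1 → x ≢ 0ℚ → NonZero ∣ N ∣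
numerator-nonZero {b} {k} {x} {N} bᵏx≡N x≢0 = ℕ.≢-nonZero λ ∣N∣≡0 →
  x≢0 (p*q≡0⇒q≡0 (ℕtoℚ (b ^ k)) x (trans bᵏx≡N (cong (_/ 1) (ℤP.∣i∣≡0⇒i≡0 {N} ∣N∣≡0))))
  where instance _ = ℕtoℚ-nonZero (b ^ k) {{ℕP.m^n≢0 b k}}

nonvanishing⇒avoided-modulus : ∀ {a b} {u : ℤ → ℚ} .{{_ : NonZero b}} → a ≢ 0ℚ →
  (∀ n → InZinv b (u n)) → (∀ n → u (n +ℤ 1ℤ) ≡ a * u n) → (∀ n → u n ≢ 0ℚ) →
  ∃[ m ] (2 ≤ m × gcd b m ≡ 1 × (∀ n → ¬ InMulZinv b m (u n)))
nonvanishing⇒avoided-modulus {a} {b} {u} a≢0 u∈ℤ[1/b] u-rec u≢0 with u∈ℤ[1/b] 0ℤ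
... | k , N , bᵏu₀≡N =
  suc K , s≤s (ℕ.>-nonZero⁻¹ K) , coprime⇒gcd≡1 (coprime-sym m⊥b) , u∉mℤ[1/b]
  where
  instance
    N≢0 = numerator-nonZero {b} {k} {u 0ℤ} {N} bᵏu₀≡N (u≢0 0ℤ)
    ↥a≢0 = ℕ.≢-nonZero (a≢0 ∘ ℚP.↥p≡0⇒p≡0 a ∘ ℤP.∣i∣≡0⇒i≡0)
  K = b ℕ.* ∣ N ∣ ℕ.* ∣ ↥ a ∣ ℕ.* ↧ₙ a
  instance
    K≢0 : NonZero K
    K≢0 = ℕP.m*n≢0 (b ℕ.* ∣ N ∣ ℕ.* ∣ ↥ a ∣) (↧ₙ a)
            {{ℕP.m*n≢0 (b ℕ.* ∣ N ∣) ∣ ↥ a ∣ {{ℕP.m*n≢0 b ∣ N ∣}}}}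
  N∣K : ∣ N ∣ ∣ K
  N∣K = ∣m⇒∣m*n (↧ₙ a) (n∣m*n*o b ∣ ↥ a ∣)
  m⊥b : Coprime (suc K) b
  m⊥b = ∣⇒coprime-suc (∣m⇒∣m*n (↧ₙ a) (∣m⇒∣m*n ∣ ↥ a ∣ (m∣m*n ∣ N ∣)))
  m⊥↥a : Coprime (suc K) ∣ ↥ a ∣
  m⊥↥a = ∣⇒coprime-suc (∣m⇒∣m*n (↧ₙ a) (n∣m*n (b ℕ.* ∣ N ∣)))
  m⊥↧a : Coprime (suc K) ∣ ↧ a ∣
  m⊥↧a = ∣⇒coprime-suc (n∣m*n (b ℕ.* ∣ N ∣ ℕ.* ∣ ↥ a ∣))
  u∉mℤ[1/b] : ∀ n → ¬ InMulZinv b (suc K) (u n)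
  u∉mℤ[1/b] n uₙ∈mℤ[1/b] = suc-∤-divisor N∣K
    (InMulZinv⇒∣numerator {b} {suc K} {k} {u 0ℤ} {N} m⊥b bᵏu₀≡N
      (InMulZinv-at-0 {a} {b} {suc K} {u} m⊥b m⊥↥a m⊥↧a u∈ℤ[1/b] u-rec n uₙ∈mℤ[1/b]))

mainTheorem1 : (a₁ : ℚ) → a₁ ≢ 0ℚ → (b : ℕ) → 1 ≤ b → (u : ℤ → ℚ)
    → (∀ n → InZinv b (u n))
    → (∀ n → u (n +ℤ 1ℤ) ≡ a₁ * u n)
    → ((∀ n → u n ≢ 0ℚ)
       ⇔ (∃[ m ] (2 ≤ m × gcd b m ≡ 1 × (∀ n → ¬ InMulZinv b m (u n)))))
mainTheorem1 a a≢0 b 1≤b u u∈ℤ[1/b] u-rec =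
  mk⇔ (nonvanishing⇒avoided-modulus {{ℕ.>-nonZero 1≤b}} a≢0 u∈ℤ[1/b] u-rec)
      avoided-modulus⇒nonvanishing
  where
  avoided-modulus⇒nonvanishing :
    ∃[ m ] (2 ≤ m × gcd b m ≡ 1 × (∀ n → ¬ InMulZinv b m (u n))) → ∀ n → u n ≢ 0ℚ
  avoided-modulus⇒nonvanishing (m , _ , _ , u∉mℤ[1/b]) n uₙ≡0 =
    u∉mℤ[1/b] n (subst (InMulZinv b m) (sym uₙ≡0) (InMulZinv-0 b m))
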